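{- Let $X$ be a connected graph. Then $\gamma(X)$ is unicyclic if and only if $X$ is a tree with maximum degree $\Delta(X)=3$ having exactly one vertex of degree three.
   Context: All graphs are finite, without loops or multiple edges. For a graph $X$ with $m$ edges, orient each edge arbitrarily and label the oriented edges $e_1,\dots,e_m$; put $e_{m+i}=e_i^{ -1}$ ($e_i$ reversed), and write $s(e),t(e)$ for the starting and terminal vertex of an oriented edge $e$. The edge adjacency matrix $M$ is the $2m\times 2m$ matrix with $M_{ij}=1$ if $t(e_i)=s(e_j)$ and $s(e_i)\neq t(e_j)$, and $0$ otherwise. The symmetric edge graph $\gamma(X)$ is the graph on the $2m$ vertices $e_1,\dots,e_{2m}$ with adjacency matrix $M+M^T$; equivalently, its vertices are the ordered pairs $(u,v)$ with $uv\in E(X)$, and $(u,v)\sim(x,y)$ iff ($v=x$ and $y\neq u$) or ($y=u$ and $x\neq v$). A graph is unicyclic if it contains exactly one cycle. -}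

module Defs where

open import Data.Nat using (ℕ; suc)
open import Data.Fin using (Fin; zero; suc; inject₁; fromℕ)
open import Data.Bool using (Bool; true; false)
open import Data.List using (length; filterᵇ; allFin)
open import Data.Product using (Σ; ∃; _×_; _,_; proj₁; proj₂)
open import Data.Sum using (_⊎_)
open import Data.Empty using (⊥)
open import Relation.Nullary using (¬_)
open import Relation.Binary.PropositionalEquality using (_≡_; _≢_)
open import Function.Definitions using (Injective)
open import Function.Bundles using (_⇔_)

record Graph : Set where
  field
    n     : ℕ
    adj   : Fin n → Fin n → Bool
    sym   : ∀ u v → adj u v ≡ adj v u
    irrfl : ∀ u → adj u u ≡ false

open Graph public

data Walk {V : Set} (A : V → V → Set) : V → V → Set where
  here : ∀ {u} → Walk A u u
  step : ∀ {u w v} → A u w → Walk A w v → Walk A u v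

Connected : {V : Set} → (V → V → Set) → Set
Connected {V} A = ∀ (u v : V) → Walk A u v

record Cycle {V : Set} (A : V → V → Set) : Set where
  field
    k     : ℕ
    c     : Fin (suc (suc (suc k))) → V
    inj   : Injective _≡_ _≡_ c
    cons  : ∀ (i : Fin (suc (suc k))) → A (c (inject₁ i)) (c (suc i))
    close : A (c (fromℕ (suc (suc k)))) (c zero)

open Cycle public

CycleEdge : {V : Set} {A : V → V → Set} → Cycle A → V → V → Set
CycleEdge C u v =
    (∃ λ i → (u ≡ c C (inject₁ i) × v ≡ c C (suc i))
           ⊎ (v ≡ c C (inject₁ i) × u ≡ c C (suc i)))
  ⊎ ((u ≡ c C (fromℕ _) × v ≡ c C zero) ⊎ (v ≡ c C (fromℕ _) × u ≡ c C zero))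

-- Two cycles are the same cycle (subgraph) iff they have the same edge set.
SameCycle : {V : Set} {A : V → V → Set} → Cycle A → Cycle A → Set
SameCycle {V} C D = ∀ (u v : V) → CycleEdge C u v ⇔ CycleEdge D u v

Unicyclic : {V : Set} → (V → V → Set) → Set
Unicyclic A = Σ (Cycle A) λ C → ∀ (D : Cycle A) → SameCycle C D

Acyclic : {V : Set} → (V → V → Set) → Set
Acyclic A = ¬ Cycle A

Adj : (X : Graph) → Fin (n X) → Fin (n X) → Set
Adj X u v = adj X u v ≡ true

IsConnected : Graph → Set
IsConnected X = Connected (Adj X)

IsTree : Graph → Set
IsTree X = IsConnected X × Acyclic (Adj X)

degree : (X : Graph) → Fin (n X) → ℕ
degree X u = length (filterᵇ (adj X u) (allFin (n X)))

MaxDegree3 : Graph → Set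
MaxDegree3 X = (∀ u → degree X u Data.Nat.≤ 3) × (∃ λ u → degree X u ≡ 3)

UniqueDegree3 : Graph → Set
UniqueDegree3 X = ∃ λ u → degree X u ≡ 3 × (∀ w → degree X w ≡ 3 → w ≡ u)

-- Symmetric edge graph γ(X): vertices are ordered pairs (u,v) with uv ∈ E(X);
-- (u,v) ~ (x,y) iff (v = x and y ≠ u) or (y = u and x ≠ v).
γV : Graph → Set
γV X = Σ (Fin (n X) × Fin (n X)) λ p → Adj X (proj₁ p) (proj₂ p)

γAdj : (X : Graph) → γV X → γV X → Set
γAdj X ((u , v) , _) ((x , y) , _) = (v ≡ x × y ≢ u) ⊎ (y ≡ u × x ≢ v)

-- An arc (u, v) of X followed by an arc (v, y) with y ≢ u is a step of a non-backtracking walk, and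
-- γ(X) joins two arcs exactly when one follows the other; so each step along a cycle of γ(X) is a
-- forward or a backward turn. A run of forward turns traces a non-backtracking walk in X, which closes
-- into a cycle of X when it returns to its start; a switch of direction happens only at a vertex with
-- three distinct neighbours a, b, d, and every such vertex c carries the hexagon
-- (a,c) (c,b) (d,c) (c,a) (b,c) (c,d) in γ(X).
-- If γ(X) has a single cycle, then X is acyclic (a cycle of X gives two γ-cycles, one per direction),
-- no vertex has four neighbours and no two vertices have three (either would give two hexagons), and
-- some vertex has three, since a cycle of γ(X) must switch direction somewhere. Conversely, if X is a
-- forest whose only vertex of degree 3 is c, every cycle of γ(X) switches direction at every step,
-- always pivoting at c, and then passes through every turn at c: it is the hexagon at c.

module Submission where

open import Defs hiding (sym)

open import Axiom.UniquenessOfIdentityProofs using (module Decidable⇒UIP)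
open import Data.Bool using (Bool; true; false)
import Data.Bool.Properties as Bool
open import Data.Empty using (⊥-elim)
open import Data.Fin using (Fin; zero; suc; inject₁; inject≤; fromℕ; toℕ; punchIn)
open import Data.Fin.Patterns using (0F; 1F; 2F; 3F; 4F; 5F)
open import Data.Fin.Properties
  using (toℕ-inject₁; toℕ-fromℕ; toℕ-injective; toℕ<n; injective⇒≤; inject≤-injective; ¬Fin0; any?; all?; _≟_;
         punchIn-injective; punchInᵢ≢i)
open import Data.Fin.Relation.Unary.Top using (view; ‵fromℕ; ‵inj₁; view-fromℕ; view-inject₁)
open import Data.List using (List; _∷_; lookup; filterᵇ; allFin)
open import Data.List.Membership.Propositional using (_∈_)
open import Data.List.Membership.Propositional.Properties using (∈-filter⁺; ∈-filter⁻; ∈-allFin; ∈-lookup)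
open import Data.List.Membership.Setoid.Properties using (index-injective)
import Data.List.Relation.Unary.All as All
open import Data.List.Relation.Unary.AllPairs using (_∷_)
open import Data.List.Relation.Unary.Any using (index)
open import Data.List.Relation.Unary.Unique.Propositional using (Unique)
import Data.List.Relation.Unary.Unique.Propositional.Properties as Unique
open import Data.Nat using (ℕ; zero; suc; _+_; _≤_; _<_; z≤n; s≤s; s≤s⁻¹)
open import Data.Nat.Properties
  using (≤-refl; ≤-trans; <-trans; ≤-antisym; ≤-reflexive; <⇒≤; ≤⇒≯; ≮⇒≥; <-cmp; n<1+n; m<n⇒m<1+n;
         m<1+n⇒m<n∨m≡n; m≤n+m; m≤n⇒∃[o]m+o≡n; m≢1+n+m; suc-injective; +-comm; +-suc; +-monoˡ-≤; +-cancelʳ-≡;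
         +-commutativeSemigroup; anyUpTo?)
open import Algebra.Properties.CommutativeSemigroup +-commutativeSemigroup using (xy∙z≈xz∙y)
open import Data.Product using (∃; _×_; _,_; proj₁; proj₂)
import Data.Product as Product
open import Data.Product.Properties using (≡-dec)
open import Data.Sum using (_⊎_; inj₁; inj₂; [_,_]′)
import Data.Sum as Sum
import Data.Vec.Functional as Vector
open import Function.Base using (_∘_)
open import Function.Bundles using (_⇔_; mk⇔; Equivalence)
import Function.Properties.Equivalence as ⇔
open import Function.Definitions using (Injective)
open import Relation.Binary.Definitions using (DecidableEquality; tri<; tri≈; tri>)
open import Relation.Binary.PropositionalEquality
  using (_≡_; _≢_; refl; sym; trans; cong; subst; subst₂; setoid; module ≡-Reasoning)
open import Relation.Nullary using (¬_; yes; no; contradiction)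
open import Relation.Nullary.Decidable using (T?; toWitness; _→-dec_)

all-or-first : {P Q : ℕ → Set} → (∀ t → P t ⊎ Q t) → ∀ m →
  (∀ t → t < m → P t) ⊎ (∃ λ e → e < m × Q e × (∀ t → t < e → P t))
all-or-first dec zero = inj₁ λ _ ()
all-or-first dec (suc m) with all-or-first dec m
... | inj₂ (e , e<m , qe , below) = inj₂ (e , m<n⇒m<1+n e<m , qe , below)
... | inj₁ below with dec m
...   | inj₂ qm = inj₂ (m , n<1+n m , qm , below)
...   | inj₁ pm = inj₁ λ t t<1+m → [ below t , (λ { refl → pm }) ]′ (m<1+n⇒m<n∨m≡n t<1+m)

module _ {m : ℕ} where

  next : Fin (suc m) → Fin (suc m)
  next i with view i
  ... | ‵fromℕ          = zero
  ... | ‵inj₁ {i = j} _ = suc j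

  next-fromℕ : next (fromℕ m) ≡ zero
  next-fromℕ rewrite view-fromℕ m = refl

  next-inject₁ : (i : Fin m) → next (inject₁ i) ≡ suc i
  next-inject₁ i rewrite view-inject₁ i = refl

  toℕ-next : (i : Fin (suc m)) → (toℕ i ≡ m × next i ≡ zero) ⊎ toℕ (next i) ≡ suc (toℕ i)
  toℕ-next i with view i
  ... | ‵fromℕ          = inj₁ (toℕ-fromℕ m , refl)
  ... | ‵inj₁ {i = j} _ = inj₂ (cong suc (sym (toℕ-inject₁ j)))

  position : ℕ → Fin (suc m)
  position zero    = zero
  position (suc j) = next (position j)

  position-toℕ : ∀ j {i : Fin (suc m)} → toℕ i ≡ j → position j ≡ i
  position-toℕ zero    {zero}  _    = refl
  position-toℕ (suc j) {suc i} i≡j = begin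
    next (position j)      ≡⟨ cong next (position-toℕ j (trans (toℕ-inject₁ i) (suc-injective i≡j))) ⟩
    next (inject₁ i)       ≡⟨ next-inject₁ i ⟩
    suc i                  ∎
    where open ≡-Reasoning

  position-periodic : ∀ j → position (j + suc m) ≡ position j
  position-periodic zero    = trans (cong next (position-toℕ m (toℕ-fromℕ m))) next-fromℕ
  position-periodic (suc j) = cong next (position-periodic j)

next²≢id : ∀ {k} (i : Fin (3 + k)) → next (next i) ≢ i
next²≢id i eq with toℕ-next i | toℕ-next (next i)
... | inj₁ (_ , i⁺≡0) | inj₁ (i⁺≡last , _) =
  contradiction (trans (cong toℕ (sym i⁺≡0)) i⁺≡last) λ ()
... | inj₁ (i≡last , i⁺≡0) | inj₂ i⁺⁺≡1+i⁺ =
  contradiction (trans (sym (trans i⁺⁺≡1+i⁺ (cong (suc ∘ toℕ) i⁺≡0))) (trans (cong toℕ eq) i≡last)) λ ()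
... | inj₂ i⁺≡1+i | inj₁ (i⁺≡last , i⁺⁺≡0) =
  contradiction (trans (sym (trans i⁺≡1+i (cong (suc ∘ toℕ) (trans (sym eq) i⁺⁺≡0)))) i⁺≡last) λ ()
... | inj₂ i⁺≡1+i | inj₂ i⁺⁺≡1+i⁺ =
  m≢1+n+m (toℕ i) (trans (sym (cong toℕ eq)) (trans i⁺⁺≡1+i⁺ (cong suc i⁺≡1+i)))

-- Closed walks and cycles

SamePair : {V : Set} → V → V → V → V → Set
SamePair u v x y = (u ≡ x × v ≡ y) ⊎ (v ≡ x × u ≡ y)

record ClosedWalk {V : Set} (A : V → V → Set) (period : ℕ) : Set where
  field
    vertex          : ℕ → V
    periodic        : ∀ j → vertex (j + period) ≡ vertex j
    adjacent        : ∀ j → A (vertex j) (vertex (suc j))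
    nonBacktracking : ∀ j → vertex j ≢ vertex (2 + j)

  WalkEdge : V → V → Set
  WalkEdge u v = ∃ λ j → SamePair u v (vertex j) (vertex (suc j))

open ClosedWalk

module _ {V : Set} {A : V → V → Set} where

  shift : ∀ {p} → ClosedWalk A p → ℕ → ClosedWalk A p
  shift {p} W a = record
    { vertex          = λ t → vertex W (t + a)
    ; periodic        = λ j → trans (cong (vertex W) (xy∙z≈xz∙y j p a)) (periodic W (j + a))
    ; adjacent        = λ j → adjacent W (j + a)
    ; nonBacktracking = λ j → nonBacktracking W (j + a)
    }

  cycleFromNext : ∀ {k} (w : Fin (3 + k) → V) → Injective _≡_ _≡_ w → (∀ f → A (w f) (w (next f))) → Cycle A
  cycleFromNext w w-injective w-adjacent = record
    { k     = _
    ; c     = w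
    ; inj   = w-injective
    ; cons  = λ i → subst (A (w (inject₁ i)) ∘ w) (next-inject₁ i) (w-adjacent (inject₁ i))
    ; close = subst (A (w (fromℕ _)) ∘ w) next-fromℕ (w-adjacent (fromℕ _))
    }

module _ {V : Set} {A : V → V → Set} (C : Cycle A) where

  next-adjacent : ∀ f → A (c C f) (c C (next f))
  next-adjacent f with view f
  ... | ‵fromℕ          = close C
  ... | ‵inj₁ {i = i} _ = cons C i

  cycleEdge⇔next : ∀ {u v} → CycleEdge C u v ⇔ ∃ λ f → SamePair u v (c C f) (c C (next f))
  cycleEdge⇔next {u} {v} = mk⇔ to from
    where
    to : CycleEdge C u v → ∃ λ f → SamePair u v (c C f) (c C (next f))
    to (inj₁ (i , e)) = inject₁ i , subst (SamePair u v (c C (inject₁ i)) ∘ c C) (sym (next-inject₁ i)) e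
    to (inj₂ e)       = fromℕ _ , subst (SamePair u v (c C (fromℕ _)) ∘ c C) (sym next-fromℕ) e
    from : (∃ λ f → SamePair u v (c C f) (c C (next f))) → CycleEdge C u v
    from (f , e) with view f
    ... | ‵fromℕ          = inj₂ e
    ... | ‵inj₁ {i = i} _ = inj₁ (i , e)

  cycleEdge⇒vertex : ∀ {u v} → CycleEdge C u v → ∃ λ f → u ≡ c C f
  cycleEdge⇒vertex e with Equivalence.to cycleEdge⇔next e
  ... | f , inj₁ (u≡ , _) = f , u≡
  ... | f , inj₂ (_ , u≡) = next f , u≡

  walk : ClosedWalk A (3 + k C)
  walk = record
    { vertex          = c C ∘ position
    ; periodic        = cong (c C) ∘ position-periodic
    ; adjacent        = next-adjacent ∘ position
    ; nonBacktracking = λ j eq → next²≢id (position j) (sym (inj C eq))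
    }

  cycleEdge⇔walkEdge : ∀ {u v} → CycleEdge C u v ⇔ WalkEdge walk u v
  cycleEdge⇔walkEdge {u} {v} = mk⇔
    (λ e → let (f , e′) = Equivalence.to cycleEdge⇔next e
               pos = position-toℕ (toℕ f) refl
           in toℕ f , subst₂ (SamePair u v) (cong (c C) (sym pos)) (cong (c C ∘ next) (sym pos)) e′)
    (λ (j , e) → Equivalence.from cycleEdge⇔next (position j , e))

unicyclic⇒sameCycle : {V : Set} {A : V → V → Set} → Unicyclic A → (D D′ : Cycle A) → SameCycle D D′
unicyclic⇒sameCycle (_ , same) D D′ u v = ⇔.trans (⇔.sym (same D u v)) (same D′ u v)

sameCycle⇒vertex : {V : Set} {A : V → V → Set} {C D : Cycle A} → SameCycle C D → ∀ f → ∃ λ f′ → c C f ≡ c D f′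
sameCycle⇒vertex {C = C} {D} same f =
  cycleEdge⇒vertex D (Equivalence.to (same _ _) (Equivalence.from (cycleEdge⇔next C) (f , inj₁ (refl , refl))))

InjectiveBelow : {V : Set} → (ℕ → V) → ℕ → Set
InjectiveBelow h l = ∀ {p q} → p < l → q < l → h p ≡ h q → p ≡ q

module _ {V : Set} {A : V → V → Set} (irreflexive : ∀ {x} → ¬ A x x) where

  injectiveLoop⇒Cycle : ∀ l (h : ℕ → V) → 0 < l → h l ≡ h 0 → InjectiveBelow h l →
    (∀ t → t < l → A (h t) (h (suc t))) → (∀ t → 2 + t ≤ l → h (2 + t) ≢ h t) → Cycle A
  injectiveLoop⇒Cycle 1 h _ closed _ adj _ = ⊥-elim (irreflexive (subst (A (h 0)) closed (adj 0 ≤-refl)))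
  injectiveLoop⇒Cycle 2 h _ closed _ _ nb  = ⊥-elim (nb 0 ≤-refl closed)
  injectiveLoop⇒Cycle (suc (suc (suc k))) h _ closed h-injective adj _ = record
    { k     = k
    ; c     = h ∘ toℕ
    ; inj   = λ {i} {j} eq → toℕ-injective (h-injective (toℕ<n i) (toℕ<n j) eq)
    ; cons  = λ i → subst (λ t → A (h t) (h (suc (toℕ i)))) (sym (toℕ-inject₁ i))
                      (adj (toℕ i) (m<n⇒m<1+n (toℕ<n i)))
    ; close = subst₂ A (cong h (sym (toℕ-fromℕ (2 + k)))) closed (adj (2 + k) ≤-refl)
    }

  module _ (_≟_ : DecidableEquality V) where

    nonBacktrackingLoop⇒Cycle : ∀ m (h : ℕ → V) → 0 < m → h m ≡ h 0 →
      (∀ t → t < m → A (h t) (h (suc t))) → (∀ t → 2 + t ≤ m → h (2 + t) ≢ h t) → Cycle A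
    nonBacktrackingLoop⇒Cycle m h 0<m closed adj nb with all-or-first repeats? (suc m)
      where
      Repeats : ℕ → Set
      Repeats s = ∃ λ i → i < s × h i ≡ h s
      repeats? : ∀ s → ¬ Repeats s ⊎ Repeats s
      repeats? s with anyUpTo? (λ i → h i ≟ h s) s
      ... | yes r = inj₂ r
      ... | no ¬r = inj₁ ¬r
    ... | inj₁ fresh = ⊥-elim (fresh m ≤-refl (0 , 0<m , sym closed))
    ... | inj₂ (e , e<1+m , (i , i<e , hi≡he) , fresh) with m≤n⇒∃[o]m+o≡n i<e
    ...   | o , 1+i+o≡e = injectiveLoop⇒Cycle (suc o) (λ t → h (t + i)) (s≤s z≤n)
                            (trans (cong h 1+o+i≡e) (sym hi≡he))
                            (λ p<l q<l eq → +-cancelʳ-≡ i _ _ (h-injective (within p<l) (within q<l) eq))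
                            (λ t t<l → adj (t + i) (≤-trans (within t<l) (s≤s⁻¹ e<1+m)))
                            (λ t 2+t≤l → nb (t + i) (≤-trans (within 2+t≤l) (s≤s⁻¹ e<1+m)))
      where
      1+o+i≡e : suc o + i ≡ e
      1+o+i≡e = trans (cong suc (+-comm o i)) 1+i+o≡e
      within : ∀ {t} → t ≤ suc o → t + i ≤ e
      within t≤l = subst (_ ≤_) 1+o+i≡e (+-monoˡ-≤ i t≤l)
      h-injective : InjectiveBelow h e
      h-injective {p} {q} p<e q<e eq with <-cmp p q
      ... | tri< p<q _ _ = ⊥-elim (fresh q q<e (p , p<q , eq))
      ... | tri≈ _ p≡q _ = p≡q
      ... | tri> _ _ q<p = ⊥-elim (fresh p p<e (q , q<p , sym eq))

-- Stars and degrees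

Unique⇒lookup-injective : {A : Set} {xs : List A} → Unique xs → Injective _≡_ _≡_ (lookup xs)
Unique⇒lookup-injective {xs = _ ∷ _}  (_ ∷ _)      {zero}  {zero}  _  = refl
Unique⇒lookup-injective {xs = _ ∷ _}  (x∉xs ∷ _)   {zero}  {suc j} eq = ⊥-elim (All.lookup x∉xs (∈-lookup j) eq)
Unique⇒lookup-injective {xs = _ ∷ _}  (x∉xs ∷ _)   {suc i} {zero}  eq = ⊥-elim (All.lookup x∉xs (∈-lookup i) (sym eq))
Unique⇒lookup-injective {xs = _ ∷ _}  (_ ∷ unique) {suc i} {suc j} eq = cong suc (Unique⇒lookup-injective unique eq)

∷-injective : {A : Set} {k : ℕ} {x : A} {f : Fin k → A} →
  (∀ i → f i ≢ x) → Injective _≡_ _≡_ f → Injective _≡_ _≡_ (x Vector.∷ f)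
∷-injective _   _           {zero}  {zero}  _  = refl
∷-injective x∉f _           {zero}  {suc j} eq = ⊥-elim (x∉f j (sym eq))
∷-injective x∉f _           {suc i} {zero}  eq = ⊥-elim (x∉f i eq)
∷-injective _   f-injective {suc i} {suc j} eq = cong suc (f-injective eq)

module _ (X : Graph) where

  adj-sym : ∀ {u v} → Adj X u v → Adj X v u
  adj-sym {u} {v} uv = trans (Graph.sym X v u) uv

  adj-irreflexive : ∀ {u} → ¬ Adj X u u
  adj-irreflexive {u} uu = contradiction (trans (sym uu) (irrfl X u)) λ ()

  adj⇒≢ : ∀ {u v} → Adj X u v → u ≢ v
  adj⇒≢ uv refl = adj-irreflexive uv

  neighbours : Fin (n X) → List (Fin (n X))
  neighbours u = filterᵇ (adj X u) (allFin (n X))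

  ∈-neighbours⁺ : ∀ {u v} → Adj X u v → v ∈ neighbours u
  ∈-neighbours⁺ {u} {v} uv = ∈-filter⁺ (λ w → T? (adj X u w)) (∈-allFin v) (Equivalence.from Bool.T-≡ uv)

  ∈-neighbours⁻ : ∀ {u v} → v ∈ neighbours u → Adj X u v
  ∈-neighbours⁻ {u} v∈ = Equivalence.to Bool.T-≡ (proj₂ (∈-filter⁻ (λ w → T? (adj X u w)) {xs = allFin (n X)} v∈))

  neighbours-unique : ∀ u → Unique (neighbours u)
  neighbours-unique u = Unique.filter⁺ (λ w → T? (adj X u w)) (Unique.allFin⁺ (n X))

record Star (X : Graph) (u : Fin (n X)) (k : ℕ) : Set where
  field
    leaf           : Fin k → Fin (n X)
    leaf-injective : Injective _≡_ _≡_ leaf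
    leaf-adjacent  : ∀ i → Adj X u (leaf i)

open Star

module _ {X : Graph} {u : Fin (n X)} where

  Star⇒≤degree : ∀ {k} → Star X u k → k ≤ degree X u
  Star⇒≤degree s = injective⇒≤ {f = index ∘ ∈-neighbours⁺ X ∘ leaf-adjacent s}
    (λ eq → leaf-injective s (index-injective (setoid _) _ _ eq))

  ≤degree⇒Star : ∀ {k} → k ≤ degree X u → Star X u k
  ≤degree⇒Star k≤d = record
    { leaf           = λ i → lookup (neighbours X u) (inject≤ i k≤d)
    ; leaf-injective = inject≤-injective k≤d k≤d _ _ ∘ Unique⇒lookup-injective (neighbours-unique X u)
    ; leaf-adjacent  = λ i → ∈-neighbours⁻ X (∈-lookup (inject≤ i k≤d))
    }

  noLeaves : Star X u 0
  noLeaves = record { leaf = Vector.[] ; leaf-injective = λ {i} → ⊥-elim (¬Fin0 i) ; leaf-adjacent = λ () }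

  addLeaf : ∀ {k x} (s : Star X u k) → Adj X u x → (∀ i → leaf s i ≢ x) → Star X u (suc k)
  addLeaf s ux x-new = record
    { leaf           = _ Vector.∷ leaf s
    ; leaf-injective = ∷-injective x-new (leaf-injective s)
    ; leaf-adjacent  = λ { zero → ux ; (suc i) → leaf-adjacent s i }
    }

  restrict : ∀ {j k} → Star X u k → (g : Fin j → Fin k) → Injective _≡_ _≡_ g → Star X u j
  restrict s g g-injective = record
    { leaf           = leaf s ∘ g
    ; leaf-injective = g-injective ∘ leaf-injective s
    ; leaf-adjacent  = leaf-adjacent s ∘ g
    }

  star₃ : ∀ {a b d} → Adj X u a → Adj X u b → Adj X u d → a ≢ b → a ≢ d → b ≢ d → Star X u 3
  star₃ ua ub ud a≢b a≢d b≢d =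
    addLeaf (addLeaf (addLeaf noLeaves ud λ ()) ub λ { zero → b≢d ∘ sym })
            ua λ { zero → a≢b ∘ sym ; (suc zero) → a≢d ∘ sym }

  maximalStar⇒leaf : ∀ {k z} → degree X u ≤ k → (s : Star X u k) → Adj X u z → ∃ λ i → leaf s i ≡ z
  maximalStar⇒leaf {z = z} degree≤k s uz with any? (λ i → leaf s i ≟ z)
  ... | yes z-leaf = z-leaf
  ... | no z-new   = contradiction (Star⇒≤degree (addLeaf s uz λ i eq → z-new (i , eq))) (≤⇒≯ degree≤k)

-- Arcs of X as the vertices of γ(X)

-- Corner i of the hexagon is the arc between the centre and leaf (i mod 3), pointing to the centre for even i.
corner : Fin 6 → Bool × Fin 3
corner 0F = true  , 0F
corner 1F = false , 1F
corner 2F = true  , 2F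
corner 3F = false , 0F
corner 4F = true  , 1F
corner 5F = false , 2F

corner-injective : Injective _≡_ _≡_ corner
corner-injective {i} {j} = toWitness {a? = all? λ i → all? λ j → (corner i ≟× corner j) →-dec (i ≟ j)} _ i j
  where _≟×_ = ≡-dec Bool._≟_ _≟_

module _ (X : Graph) where

  Arc : Set
  Arc = γV X

  tail head : Arc → Fin (n X)
  tail = proj₁ ∘ proj₁
  head = proj₂ ∘ proj₁

  reverse : Arc → Arc
  reverse ((u , v) , uv) = (v , u) , adj-sym X uv

  arc-≡ : ∀ {a b : Arc} → tail a ≡ tail b → head a ≡ head b → a ≡ b
  arc-≡ {(u , v) , _} refl refl = cong ((u , v) ,_) (Decidable⇒UIP.≡-irrelevant Bool._≟_ _ _)

  reverse-injective : ∀ {a b} → reverse a ≡ reverse b → a ≡ b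
  reverse-injective eq = arc-≡ (cong head eq) (cong tail eq)

  record _↝_ (a b : Arc) : Set where
    constructor _,_
    field
      link    : head a ≡ tail b
      noUTurn : head b ≢ tail a

  open _↝_

  ↝-asym : ∀ {a b} → a ↝ b → ¬ (b ↝ a)
  ↝-asym (a⁺≡b⁻ , _) (_ , a⁺≢b⁻) = a⁺≢b⁻ a⁺≡b⁻

  ↝-reverse : ∀ {a b} → a ↝ b → reverse b ↝ reverse a
  ↝-reverse (a⁺≡b⁻ , b⁺≢a⁻) = sym a⁺≡b⁻ , b⁺≢a⁻ ∘ sym

  ↝-reverse⁻ : ∀ {a b} → reverse a ↝ reverse b → b ↝ a
  ↝-reverse⁻ (a⁻≡b⁺ , b⁻≢a⁺) = sym a⁻≡b⁺ , b⁻≢a⁺ ∘ sym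

  γAdj⇒↝ : ∀ {a b} → γAdj X a b → a ↝ b ⊎ b ↝ a
  γAdj⇒↝ (inj₁ (a⁺≡b⁻ , b⁺≢a⁻)) = inj₁ (a⁺≡b⁻ , b⁺≢a⁻)
  γAdj⇒↝ (inj₂ (b⁺≡a⁻ , b⁻≢a⁺)) = inj₂ (b⁺≡a⁻ , b⁻≢a⁺ ∘ sym)

  ↝⇒γAdj : ∀ {a b} → a ↝ b ⊎ b ↝ a → γAdj X a b
  ↝⇒γAdj (inj₁ (a⁺≡b⁻ , b⁺≢a⁻)) = inj₁ (a⁺≡b⁻ , b⁺≢a⁻)
  ↝⇒γAdj (inj₂ (b⁺≡a⁻ , a⁺≢b⁻)) = inj₂ (b⁺≡a⁻ , a⁺≢b⁻ ∘ sym)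

  module Hexagon {u : Fin (n X)} (s : Star X u 3) where

    spoke : Bool × Fin 3 → Arc
    spoke (true  , i) = (leaf s i , u) , adj-sym X (leaf-adjacent s i)
    spoke (false , i) = (u , leaf s i) , leaf-adjacent s i

    spoke-injective : Injective _≡_ _≡_ spoke
    spoke-injective {true  , _} {true  , _} eq = cong (true ,_) (leaf-injective s (cong tail eq))
    spoke-injective {false , _} {false , _} eq = cong (false ,_) (leaf-injective s (cong head eq))
    spoke-injective {true  , i} {false , _} eq = ⊥-elim (adj⇒≢ X (leaf-adjacent s i) (sym (cong tail eq)))
    spoke-injective {false , _} {true  , j} eq = ⊥-elim (adj⇒≢ X (leaf-adjacent s j) (cong tail eq))

    inward-adjacent : ∀ {i j} → i ≢ j → γAdj X (spoke (true , i)) (spoke (false , j))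
    inward-adjacent i≢j = inj₁ (refl , i≢j ∘ leaf-injective s ∘ sym)

    outward-adjacent : ∀ {i j} → i ≢ j → γAdj X (spoke (false , i)) (spoke (true , j))
    outward-adjacent i≢j = inj₂ (refl , i≢j ∘ leaf-injective s ∘ sym)

    hexagon : Cycle (γAdj X)
    hexagon = record
      { k     = 3
      ; c     = spoke ∘ corner
      ; inj   = corner-injective ∘ spoke-injective
      ; cons  = λ { 0F → inward-adjacent λ () ; 1F → outward-adjacent λ () ; 2F → inward-adjacent λ ()
                  ; 3F → outward-adjacent λ () ; 4F → inward-adjacent λ () }
      ; close = outward-adjacent λ ()
      }

    Spoke : Arc → Set
    Spoke a = ∃ λ i → SamePair (tail a) (head a) (leaf s i) u

    hexagon-spoke : ∀ f → Spoke (c hexagon f)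
    hexagon-spoke f with corner f
    ... | true  , i = i , inj₁ (refl , refl)
    ... | false , i = i , inj₂ (refl , refl)

  open Hexagon using (hexagon; Spoke; hexagon-spoke)

  ↝-adjacent : ∀ {a b} → a ↝ b → Adj X (head a) (head b)
  ↝-adjacent {b = b} a↝b = subst (λ x → Adj X x (head b)) (sym (link a↝b)) (proj₂ b)

  two-successors⇒Star : ∀ {m a d} → m ↝ a → m ↝ d → a ≢ d → Star X (head m) 3
  two-successors⇒Star {m} m↝a m↝d a≢d =
    star₃ (adj-sym X (proj₂ m)) (↝-adjacent m↝a) (↝-adjacent m↝d) (noUTurn m↝a ∘ sym) (noUTurn m↝d ∘ sym)
          (λ a⁺≡d⁺ → a≢d (arc-≡ (trans (sym (link m↝a)) (link m↝d)) a⁺≡d⁺))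

  two-predecessors⇒Star : ∀ {m a d} → a ↝ m → d ↝ m → a ≢ d → Star X (tail m) 3
  two-predecessors⇒Star a↝m d↝m a≢d = two-successors⇒Star (↝-reverse a↝m) (↝-reverse d↝m) (a≢d ∘ reverse-injective)

  successor-among-two : ∀ {m a d v} → degree X (head m) ≤ 3 → m ↝ a → m ↝ d → a ≢ d → m ↝ v → v ≡ a ⊎ v ≡ d
  successor-among-two degree≤3 m↝a m↝d a≢d m↝v
    with maximalStar⇒leaf degree≤3 (two-successors⇒Star m↝a m↝d a≢d) (↝-adjacent m↝v)
  ... | 0F , m⁻≡v⁺ = ⊥-elim (noUTurn m↝v (sym m⁻≡v⁺))
  ... | 1F , a⁺≡v⁺ = inj₁ (arc-≡ (trans (sym (link m↝v)) (link m↝a)) (sym a⁺≡v⁺))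
  ... | 2F , d⁺≡v⁺ = inj₂ (arc-≡ (trans (sym (link m↝v)) (link m↝d)) (sym d⁺≡v⁺))

  predecessor-among-two : ∀ {m a d u} → degree X (tail m) ≤ 3 → a ↝ m → d ↝ m → a ≢ d → u ↝ m → u ≡ a ⊎ u ≡ d
  predecessor-among-two degree≤3 a↝m d↝m a≢d u↝m =
    Sum.map reverse-injective reverse-injective
      (successor-among-two degree≤3 (↝-reverse a↝m) (↝-reverse d↝m) (a≢d ∘ reverse-injective) (↝-reverse u↝m))

  -- Closed walks in γ(X)

  Forward Backward : ∀ {p} → ClosedWalk (γAdj X) p → ℕ → Set
  Forward  W j = vertex W j ↝ vertex W (suc j)
  Backward W j = vertex W (suc j) ↝ vertex W j

  Alternates : ∀ {p} → ClosedWalk (γAdj X) p → ℕ → Set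
  Alternates W j = (Forward W j × Backward W (suc j)) ⊎ (Backward W j × Forward W (suc j))

  direction : ∀ {p} (W : ClosedWalk (γAdj X) p) j → Forward W j ⊎ Backward W j
  direction W j = γAdj⇒↝ (adjacent W j)

  reverseWalk : ∀ {p} → ClosedWalk (γAdj X) p → ClosedWalk (γAdj X) p
  reverseWalk W = record
    { vertex          = reverse ∘ vertex W
    ; periodic        = cong reverse ∘ periodic W
    ; adjacent        = λ j → ↝⇒γAdj (Sum.swap (Sum.map ↝-reverse ↝-reverse (direction W j)))
    ; nonBacktracking = λ j → nonBacktracking W j ∘ reverse-injective
    }

  Alternates-reverse : ∀ {p} {W : ClosedWalk (γAdj X) p} {j} → Alternates (reverseWalk W) j → Alternates W j
  Alternates-reverse = Sum.swap ∘ Sum.map (Product.map ↝-reverse⁻ ↝-reverse⁻) (Product.map ↝-reverse⁻ ↝-reverse⁻)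

  forwardRun⇒Cycle : ∀ {p} (W : ClosedWalk (γAdj X) p) m → 0 < m → head (vertex W m) ≡ head (vertex W 0) →
    (∀ t → t < m → Forward W t) → Cycle (Adj X)
  forwardRun⇒Cycle W m 0<m closed forward =
    nonBacktrackingLoop⇒Cycle (adj-irreflexive X) _≟_ m (head ∘ vertex W) 0<m closed
      (λ t t<m → ↝-adjacent (forward t t<m))
      (λ t 2+t≤m eq → noUTurn (forward (suc t) 2+t≤m) (trans eq (link (forward t (<-trans (n<1+n t) 2+t≤m)))))

  forward⇒alternation : Acyclic (Adj X) → ∀ {p} (W : ClosedWalk (γAdj X) (suc p)) → Forward W 0 →
    ∃ λ i → i < suc p × Alternates W i
  forward⇒alternation acyclic {p} W f₀ with all-or-first (direction W) (suc p)
  ... | inj₁ forward = ⊥-elim (acyclic (forwardRun⇒Cycle W (suc p) (s≤s z≤n) (cong head (periodic W 0)) forward))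
  ... | inj₂ (zero  , _ , b₀ , _) = ⊥-elim (↝-asym f₀ b₀)
  ... | inj₂ (suc e , e<p , b , forward) = e , <-trans (n<1+n e) e<p , inj₁ (forward e (n<1+n e) , b)

  acyclic⇒alternation : Acyclic (Adj X) → ∀ {p} (W : ClosedWalk (γAdj X) (suc p)) → ∃ λ i → i < suc p × Alternates W i
  acyclic⇒alternation acyclic W with direction W 0
  ... | inj₁ f₀ = forward⇒alternation acyclic W f₀
  ... | inj₂ b₀ with forward⇒alternation acyclic (reverseWalk W) (↝-reverse b₀)
  ...   | i , i<p , alternates = i , i<p , Alternates-reverse {W = W} alternates

  acyclic⇒Star : Acyclic (Adj X) → Cycle (γAdj X) → ∃ λ q → Star X q 3
  acyclic⇒Star acyclic C with acyclic⇒alternation acyclic (walk C)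
  ... | i , _ , inj₁ (f , b) = _ , two-predecessors⇒Star f b (nonBacktracking (walk C) i)
  ... | i , _ , inj₂ (b , f) = _ , two-successors⇒Star b f (nonBacktracking (walk C) i)

  module CentredForest (acyclic : Acyclic (Adj X)) (centre : Fin (n X))
                 (star⇒centre : ∀ {q} → Star X q 3 → q ≡ centre) (centre-degree : degree X centre ≤ 3) where

    degree≤3 : ∀ {x} → x ≡ centre → degree X x ≤ 3
    degree≤3 refl = centre-degree

    successors⇒centre : ∀ {m a d} → m ↝ a → m ↝ d → a ≢ d → head m ≡ centre
    successors⇒centre m↝a m↝d a≢d = star⇒centre (two-successors⇒Star m↝a m↝d a≢d)

    predecessors⇒centre : ∀ {m a d} → a ↝ m → d ↝ m → a ≢ d → tail m ≡ centre
    predecessors⇒centre a↝m d↝m a≢d = star⇒centre (two-predecessors⇒Star a↝m d↝m a≢d)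

    -- Were the turn at 2 + j forward, the walk would keep turning forward up to its next backward turn; both
    -- ends of that forward run pivot at the centre, so the heads of its arcs would close up into a cycle of X.
    backward-forward⇒backward : ∀ {p} (W : ClosedWalk (γAdj X) (suc p)) {j} →
      Backward W j → Forward W (suc j) → Backward W (2 + j)
    backward-forward⇒backward {p} W {j} b f with all-or-first (direction (shift W (suc j))) (suc p)
    ... | inj₁ forward = ⊥-elim (↝-asym (forward p ≤-refl) (subst (Backward W) j+1+p≡p+1+j b-again))
      where
      b-again : Backward W (j + suc p)
      b-again = subst₂ _↝_ (sym (periodic W (suc j))) (sym (periodic W j)) b
      j+1+p≡p+1+j : j + suc p ≡ p + suc j
      j+1+p≡p+1+j = trans (+-suc j p) (sym (+-comm p (suc j)))
    ... | inj₂ (0 , _ , b₁ , _) = ⊥-elim (↝-asym f b₁)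
    ... | inj₂ (1 , _ , b₂ , _) = b₂
    ... | inj₂ (suc (suc e) , _ , b′ , forward) =
      ⊥-elim (acyclic (forwardRun⇒Cycle (shift W (suc j)) (suc e) (s≤s z≤n) closed
                        (λ t t<1+e → forward t (m<n⇒m<1+n t<1+e))))
      where
      closed : head (vertex W (suc e + suc j)) ≡ head (vertex W (suc j))
      closed = begin
        head (vertex W (suc e + suc j))       ≡⟨ link (forward (suc e) ≤-refl) ⟩
        tail (vertex W (suc (suc e) + suc j)) ≡⟨ predecessors⇒centre (forward (suc e) ≤-refl) b′
                                                   (nonBacktracking (shift W (suc j)) (suc e)) ⟩
        centre                                ≡⟨ successors⇒centre b f (nonBacktracking W j) ⟨
        head (vertex W (suc j))               ∎
        where open ≡-Reasoning

    forward-backward⇒forward : ∀ {p} (W : ClosedWalk (γAdj X) (suc p)) {j} →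
      Forward W j → Backward W (suc j) → Forward W (2 + j)
    forward-backward⇒forward W f b = ↝-reverse⁻ (backward-forward⇒backward (reverseWalk W) (↝-reverse f) (↝-reverse b))

    alternates-suc : ∀ {p} (W : ClosedWalk (γAdj X) (suc p)) {j} → Alternates W j → Alternates W (suc j)
    alternates-suc W (inj₁ (f , b)) = inj₂ (b , forward-backward⇒forward W f b)
    alternates-suc W (inj₂ (b , f)) = inj₁ (f , backward-forward⇒backward W b f)

    alternates : ∀ {p} (W : ClosedWalk (γAdj X) (suc p)) j → Alternates W j
    alternates {p} W j with acyclic⇒alternation acyclic W
    ... | i , i<p , alternating with m≤n⇒∃[o]m+o≡n (≤-trans (<⇒≤ i<p) (m≤n+m (suc p) j))
    ...   | t , i+t≡j+p = Alternates-periodic (subst (Alternates W) (trans (+-comm t i) i+t≡j+p) (onwards t))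
      where
      onwards : ∀ t → Alternates W (t + i)
      onwards zero    = alternating
      onwards (suc t) = alternates-suc W (onwards t)
      Alternates-periodic : Alternates W (j + suc p) → Alternates W j
      Alternates-periodic = Sum.map (Product.map (subst₂ _↝_ (periodic W j) (periodic W (suc j)))
                                                 (subst₂ _↝_ (periodic W (2 + j)) (periodic W (suc j))))
                                    (Product.map (subst₂ _↝_ (periodic W (suc j)) (periodic W j))
                                                 (subst₂ _↝_ (periodic W (suc j)) (periodic W (2 + j))))

    -- The edges of the hexagon at the centre.
    CentreEdge : Arc → Arc → Set
    CentreEdge a b = (a ↝ b × head a ≡ centre) ⊎ (b ↝ a × head b ≡ centre)

    module _ {p} (W : ClosedWalk (γAdj X) (suc p)) where

      forward⇒head≡centre : ∀ {j} → Forward W j → head (vertex W j) ≡ centre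
      forward⇒head≡centre {j} f with alternates W j
      ... | inj₁ (_ , b) = trans (link f) (predecessors⇒centre f b (nonBacktracking W j))
      ... | inj₂ (b , _) = ⊥-elim (↝-asym f b)

      backward⇒tail≡centre : ∀ {j} → Backward W j → tail (vertex W j) ≡ centre
      backward⇒tail≡centre {j} b with alternates W j
      ... | inj₁ (f , _) = ⊥-elim (↝-asym f b)
      ... | inj₂ (_ , f) = trans (sym (link b)) (successors⇒centre b f (nonBacktracking W j))

      forward⇒backward-next : ∀ {j} → Forward W j → Backward W (suc j)
      forward⇒backward-next {j} f with alternates W j
      ... | inj₁ (_ , b) = b
      ... | inj₂ (b , _) = ⊥-elim (↝-asym f b)

      forward⇒backward-prev : ∀ {j} → Forward W (suc j) → Backward W j
      forward⇒backward-prev {j} f with alternates W j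
      ... | inj₁ (_ , b) = ⊥-elim (↝-asym f b)
      ... | inj₂ (b , _) = b

      backward⇒forward-next : ∀ {j} → Backward W j → Forward W (suc j)
      backward⇒forward-next {j} b with alternates W j
      ... | inj₁ (f , _) = ⊥-elim (↝-asym f b)
      ... | inj₂ (_ , f) = f

      backward⇒forward-prev : ∀ {j} → Backward W (suc j) → Forward W j
      backward⇒forward-prev {j} b with alternates W j
      ... | inj₁ (f , _) = f
      ... | inj₂ (_ , f) = ⊥-elim (↝-asym f b)

      consecutive⇒centreEdge : ∀ j → CentreEdge (vertex W j) (vertex W (suc j))
      consecutive⇒centreEdge j with direction W j
      ... | inj₁ f = inj₁ (f , forward⇒head≡centre f)
      ... | inj₂ b = inj₂ (b , trans (link b) (backward⇒tail≡centre b))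

      walkEdge⇒centreEdge : ∀ {u v} → WalkEdge W u v → CentreEdge u v
      walkEdge⇒centreEdge (j , inj₁ (refl , refl)) = consecutive⇒centreEdge j
      walkEdge⇒centreEdge (j , inj₂ (refl , refl)) = Sum.swap (consecutive⇒centreEdge j)

      OnForwardStep : Arc → Set
      OnForwardStep u = ∃ λ f → Forward W (suc f) × u ≡ vertex W (suc f)

      precedes-backward⇒OnForwardStep : ∀ {j u} → Backward W (2 + j) → head u ≡ centre →
        head (vertex W (2 + j)) ≢ tail u → OnForwardStep u
      precedes-backward⇒OnForwardStep {j} b u⁺≡c m⁺≢u⁻
        with predecessor-among-two (degree≤3 (backward⇒tail≡centre b)) (backward⇒forward-prev b) b
                                   (nonBacktracking W (suc j)) (trans u⁺≡c (sym (backward⇒tail≡centre b)) , m⁺≢u⁻)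
      ... | inj₁ u≡ = j , backward⇒forward-prev b , u≡
      ... | inj₂ u≡ = 2 + j , backward⇒forward-next b , u≡

      backward-exists : ∃ λ j → Backward W (2 + j)
      backward-exists with alternates W 2
      ... | inj₁ (_ , b) = 1 , b
      ... | inj₂ (b , _) = 0 , b

      -- W (2 + j) and W (4 + j) leave the centre towards different leaves, and u comes from a leaf other
      -- than at least one of them, so u precedes it.
      towards-centre⇒OnForwardStep : ∀ {u} → head u ≡ centre → OnForwardStep u
      towards-centre⇒OnForwardStep {u} u⁺≡c with backward-exists
      ... | j , b with head (vertex W (2 + j)) ≟ tail u
      ...   | no m⁺≢u⁻  = precedes-backward⇒OnForwardStep b u⁺≡c m⁺≢u⁻
      ...   | yes m⁺≡u⁻ = precedes-backward⇒OnForwardStep b′ u⁺≡c λ m′⁺≡u⁻ →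
                            nonBacktracking W (2 + j)
                              (arc-≡ (trans (backward⇒tail≡centre b) (sym (backward⇒tail≡centre b′)))
                                     (trans m⁺≡u⁻ (sym m′⁺≡u⁻)))
        where b′ = forward⇒backward-next (backward⇒forward-next b)

      throughCentre⇒walkEdge : ∀ {u v} → u ↝ v → head u ≡ centre → WalkEdge W u v
      throughCentre⇒walkEdge {u} u↝v u⁺≡c with towards-centre⇒OnForwardStep {u} u⁺≡c
      ... | f , forward , refl
        with successor-among-two (degree≤3 u⁺≡c) (forward⇒backward-prev forward) forward (nonBacktracking W f) u↝v
      ...   | inj₁ refl = f , inj₂ (refl , refl)
      ...   | inj₂ refl = suc f , inj₁ (refl , refl)

      centreEdge⇒walkEdge : ∀ {u v} → CentreEdge u v → WalkEdge W u v
      centreEdge⇒walkEdge (inj₁ (u↝v , u⁺≡c)) = throughCentre⇒walkEdge u↝v u⁺≡c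
      centreEdge⇒walkEdge (inj₂ (v↝u , v⁺≡c)) = Product.map₂ Sum.swap (throughCentre⇒walkEdge v↝u v⁺≡c)

    cycleEdge⇔centreEdge : (D : Cycle (γAdj X)) → ∀ {u v} → CycleEdge D u v ⇔ CentreEdge u v
    cycleEdge⇔centreEdge D =
      ⇔.trans (cycleEdge⇔walkEdge D) (mk⇔ (walkEdge⇒centreEdge (walk D)) (centreEdge⇒walkEdge (walk D)))

    unicyclic : Star X centre 3 → Unicyclic (γAdj X)
    unicyclic s = hexagon s , λ D u v → ⇔.trans (cycleEdge⇔centreEdge (hexagon s)) (⇔.sym (cycleEdge⇔centreEdge D))

  unicyclic⇒Spoke : Unicyclic (γAdj X) → ∀ {u w} (s : Star X u 3) (t : Star X w 3) →
    ∀ f → Spoke t (c (hexagon s) f)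
  unicyclic⇒Spoke unique s t f
    with sameCycle⇒vertex {C = hexagon s} {D = hexagon t} (unicyclic⇒sameCycle unique (hexagon s) (hexagon t)) f
  ... | f′ , eq = subst (Spoke t) (sym eq) (hexagon-spoke t f′)

  -- A cycle of X traversed in either direction gives two γ-cycles without a common vertex.
  unicyclic⇒acyclic : Unicyclic (γAdj X) → Acyclic (Adj X)
  unicyclic⇒acyclic unique C = next²≢id f (trans (cong next f⁺≡0) 1≡f)
    where
    arc : Fin (3 + k C) → Arc
    arc f = (c C f , c C (next f)) , next-adjacent C f
    arc↝ : ∀ f → arc f ↝ arc (next f)
    arc↝ f = refl , next²≢id f ∘ inj C
    along against : Cycle (γAdj X)
    along   = cycleFromNext arc (inj C ∘ cong tail) (λ f → ↝⇒γAdj (inj₁ (arc↝ f)))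
    against = cycleFromNext (reverse ∘ arc) (inj C ∘ cong head) (λ f → ↝⇒γAdj (inj₂ (↝-reverse (arc↝ f))))
    shared : ∃ λ f → arc 0F ≡ reverse (arc f)
    shared = sameCycle⇒vertex {C = along} {D = against} (unicyclic⇒sameCycle unique along against) 0F
    f = proj₁ shared
    f⁺≡0 : next f ≡ 0F
    f⁺≡0 = sym (inj C (cong tail (proj₂ shared)))
    1≡f : next 0F ≡ f
    1≡f = inj C (cong head (proj₂ shared))

  -- The hexagons on the leaves 0, 1, 2 and on 0, 1, 3 differ: only the first contains the arc from leaf 2.
  unicyclic⇒¬Star₄ : Unicyclic (γAdj X) → ∀ {u} → ¬ Star X u 4
  unicyclic⇒¬Star₄ unique {u} s with unicyclic⇒Spoke unique first second 2F
    where
    first second : Star X u 3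
    first  = restrict s (punchIn 3F) (punchIn-injective 3F _ _)
    second = restrict s (punchIn 2F) (punchIn-injective 2F _ _)
  ... | i , inj₁ (leaf₂≡ , _) = punchInᵢ≢i 2F i (sym (leaf-injective s leaf₂≡))
  ... | i , inj₂ (u≡leaf , _) = adj⇒≢ X (leaf-adjacent s (punchIn 2F i)) u≡leaf

  unicyclic⇒hexagon-touches : Unicyclic (γAdj X) → ∀ {w q} (s : Star X w 3) → Star X q 3 →
    ∀ f → tail (c (hexagon s) f) ≡ q ⊎ head (c (hexagon s) f) ≡ q
  unicyclic⇒hexagon-touches unique s t f with unicyclic⇒Spoke unique s t f
  ... | _ , inj₁ (_ , head≡q) = inj₂ head≡q
  ... | _ , inj₂ (_ , tail≡q) = inj₁ tail≡q

  unicyclic⇒unique-centre : Unicyclic (γAdj X) → ∀ {w q} → Star X w 3 → Star X q 3 → w ≡ q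
  unicyclic⇒unique-centre unique {w} {q} s t with w ≟ q | leaf s 0F ≟ q
  ... | yes w≡q | _           = w≡q
  ... | no  w≢q | no  leaf₀≢q = ⊥-elim ([ leaf₀≢q , w≢q ]′ (unicyclic⇒hexagon-touches unique s t 0F))
  ... | no  w≢q | yes leaf₀≡q = ⊥-elim ([ leaf₁≢q , w≢q ]′ (unicyclic⇒hexagon-touches unique s t 4F))
    where
    leaf₁≢q : leaf s 1F ≢ q
    leaf₁≢q leaf₁≡q = contradiction (leaf-injective s (trans leaf₀≡q (sym leaf₁≡q))) λ ()

corollary2p9 : (X : Graph) → IsConnected X →
    Unicyclic (γAdj X) ⇔ (IsTree X × MaxDegree3 X × UniqueDegree3 X)
corollary2p9 X connected = mk⇔ forward backward
  where
  forward : Unicyclic (γAdj X) → IsTree X × MaxDegree3 X × UniqueDegree3 X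
  forward unique = (connected , acyclic) , (degree≤3 , q , degree-q) , (q , degree-q , only-q)
    where
    acyclic = unicyclic⇒acyclic X unique
    degree≤3 : ∀ u → degree X u ≤ 3
    degree≤3 u = ≮⇒≥ (unicyclic⇒¬Star₄ X unique ∘ ≤degree⇒Star)
    centre = acyclic⇒Star X acyclic (proj₁ unique)
    q = proj₁ centre
    degree-q : degree X q ≡ 3
    degree-q = ≤-antisym (degree≤3 q) (Star⇒≤degree (proj₂ centre))
    only-q : ∀ w → degree X w ≡ 3 → w ≡ q
    only-q w degree-w = unicyclic⇒unique-centre X unique (≤degree⇒Star (≤-reflexive (sym degree-w))) (proj₂ centre)
  backward : IsTree X × MaxDegree3 X × UniqueDegree3 X → Unicyclic (γAdj X)
  backward ((_ , acyclic) , (degree≤3 , _) , (centre , degree-centre , only-centre)) =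
    CentredForest.unicyclic X acyclic centre
      (λ s → only-centre _ (≤-antisym (degree≤3 _) (Star⇒≤degree s))) (degree≤3 centre)
      (≤degree⇒Star (≤-reflexive (sym degree-centre)))
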